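{- Let $p\ge2$ and $K\ge1$ be integers, $s_1\ge0$ an integer, $s_2,\dots,s_p\in\mathbb{Z}$, and $z_1,\dots,z_p$ complex numbers of modulus $<1$ with $z_1\ne0$. Then $$\mathrm{La}^K_{ -s_1,s_2,\dots,s_p}(z_1,\dots,z_p)=P_{s_1}(K,z_1)\,\mathrm{La}^K_{s_2,\dots,s_p}(z_2,\dots,z_p) -\sum_{\ell=0}^{s_1}\frac{a_{1,\ell}(s_1,z_1)}{(1-z_1)^{s_1+1}z_1}\sum_{m=0}^{\ell}\binom{\ell}{m}(-1)^{\ell-m}\mathrm{La}^K_{s_2-m,s_3,\dots,s_p}(z_1z_2,z_3,\dots,z_p) -\sum_{\ell=0}^{s_1}\frac{a_{2,\ell}(s_1,z_1)}{(1-z_1)^{s_1+1}}\sum_{m=0}^{\ell}\binom{\ell}{m}(-1)^{\ell-m}\mathrm{La}^K_{s_2-m,s_3,\dots,s_p}(z_2,\dots,z_p).$$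
   Context: Truncated large polylogarithm: $\mathrm{La}^K_{s_1,\dots,s_p}(z_1,\dots,z_p)=\sum_{K\ge k_1\ge\cdots\ge k_p\ge1}\frac{z_1^{k_1}\cdots z_p^{k_p}}{k_1^{s_1}\cdots k_p^{s_p}}$. For integers $s\ge0$, $K\ge1$: $P_s(K,z)=\sum_{k=1}^Kk^sz^k=\left(z\frac{\mathrm{d}}{\mathrm{d}z}\right)^s\!\left(z\frac{1-z^K}{1-z}\right)$, which for $z\ne1$ can be written as $P_s(K,z)=\sum_{\ell=0}^s\frac{z^Ka_{1,\ell}(s,z)+a_{2,\ell}(s,z)}{(1-z)^{s+1}}K^\ell$ for all $K\ge1$, where $a_{1,\ell}(s,z),a_{2,\ell}(s,z)$ are polynomials in $z$ independent of $K$ (these are the functions $a_{1,\ell},a_{2,\ell}$ used above). -}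

module Defs where

open import Level using (Level)
open import Algebra.Bundles using (CommutativeRing)
open import Data.Nat using (ℕ; zero; suc; _∸_)
open import Data.Integer using (ℤ; +_; -[1+_])
open import Data.Vec using (Vec; []; _∷_)

module _ {c ℓ : Level} (R : CommutativeRing c ℓ) where
  open CommutativeRing R

  natR : ℕ → Carrier
  natR zero    = 0#
  natR (suc n) = 1# + natR n

  pow : Carrier → ℕ → Carrier
  pow x zero    = 1#
  pow x (suc n) = x * pow x n

  sum0 : ℕ → (ℕ → Carrier) → Carrier
  sum0 zero    f = f 0
  sum0 (suc n) f = sum0 n f + f (suc n)

  sum1 : ℕ → (ℕ → Carrier) → Carrier
  sum1 zero    f = 0#
  sum1 (suc K) f = sum1 K f + f (suc K)

  -- 1 / k^s for s ∈ ℤ, where inv k is the (assumed) inverse of k in the ring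
  invPow : (ℕ → Carrier) → ℕ → ℤ → Carrier
  invPow inv k (+ n)     = pow (inv k) n
  invPow inv k -[1+ n ]  = pow (natR k) (suc n)

  -- truncated large polylogarithm
  -- La^K_{s_1..s_p}(z_1..z_p) = Σ_{K ≥ k_1 ≥ ... ≥ k_p ≥ 1} Π z_i^{k_i} / k_i^{s_i}
  -- computed as Σ_{k_1=1}^{K} z_1^{k_1}/k_1^{s_1} · La^{k_1}_{s_2..s_p}(z_2..z_p),
  -- with the empty (p = 0) polylogarithm equal to 1.
  La : (ℕ → Carrier) → ℕ → {p : ℕ} → Vec ℤ p → Vec Carrier p → Carrier
  La inv K []       []       = 1#
  La inv K (s ∷ ss) (z ∷ zs) =
    sum1 K (λ k → pow z k * invPow inv k s * La inv k ss zs)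

  P : ℕ → ℕ → Carrier → Carrier
  P s K z = sum1 K (λ k → pow (natR k) s * pow z k)

{-# OPTIONS --safe #-}
module Submission where

open import Defs
open import Algebra.Bundles using (CommutativeRing)
open import Data.Nat as ℕ using (ℕ; zero; suc; pred; _≤_; _≥_; _∸_; z≤n; s≤s)
import Data.Nat.Properties as ℕₚ
open import Data.Nat.Combinatorics using (_C_)
open import Data.Fin using (toℕ)
open import Data.Integer as ℤ using (ℤ; +_; -[1+_]; _⊖_) renaming (_-_ to _-ℤ_; -_ to -ℤ_)
import Data.Integer.Properties as ℤₚ
open import Data.Vec using (Vec; _∷_)
open import Data.Maybe using (Maybe; just; nothing)
open import Function using (_∘_)
open import Level using (_⊔_)
open import Relation.Binary.PropositionalEquality as ≡ using (_≡_)
open import Relation.Nullary.Decidable using (yes; no)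
open import Algebra.Solver.Ring.AlmostCommutativeRing
  using (_-Raw-AlmostCommutative⟶_; fromCommutativeRing)

-- Write the left-hand side as Σ_k k^{s₁} z₁^k La^k_{s₂,…}(z₂,…). Summation by parts turns it into
-- P_{s₁}(K,z₁) La^K_{s₂,…}(z₂,…) - Σ_k T_k P_{s₁}(k-1,z₁), where T_k is the k-th summand of
-- La^K_{s₂,…}(z₂,…). Inserting the closed form of P_{s₁}(k-1,z₁), expanding (k-1)^ℓ by the binomial
-- theorem and absorbing k^m into 1/k^{s₂} gives the two double sums.
-- The closed form is only assumed for K ≥ 1, but it is needed at k - 1 = 0 too. Both sides are
-- annihilated by (E-1)^{s₁+2} (E-z₁)^{s₁+1}, E the shift; as z₁ is a unit, such a recurrence can be
-- run backwards, so agreement for K ≥ 1 forces agreement at K = 0.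

module IntegerCoefficients {c ℓ} (R : CommutativeRing c ℓ) where
  open CommutativeRing R
  open import Algebra.Properties.Ring ring using (-0#≈0#; -‿involutive; -‿+-comm; -‿distribˡ-*)
  open import Algebra.Properties.CommutativeSemigroup +-commutativeSemigroup using (interchange)
  open import Algebra.Properties.Semiring.Mult.TCOptimised semiring using (_×_; 1+×; ×-homo-+; ×1-homo-*)
  open import Relation.Binary.Reasoning.Setoid setoid

  -- The optimised _×_ makes fromℤ (+ 1) reduce to 1#, so constants in solver goals match by refl.
  fromℤ : ℤ → Carrier
  fromℤ (+ n)      = n × 1#
  fromℤ (-[1+ n ]) = - (suc n × 1#)

  fromℤ-⊖ : ∀ m n → fromℤ (m ⊖ n) ≈ m × 1# - n × 1#
  fromℤ-⊖ m zero rewrite ℤₚ.⊖-≥ {m} {0} z≤n = sym (trans (+-congˡ -0#≈0#) (+-identityʳ _))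
  fromℤ-⊖ zero (suc n) rewrite ℤₚ.⊖-< {0} {suc n} (s≤s z≤n) = sym (+-identityˡ _)
  fromℤ-⊖ (suc m) (suc n) rewrite ℤₚ.[1+m]⊖[1+n]≡m⊖n m n = begin
    fromℤ (m ⊖ n)                        ≈⟨ fromℤ-⊖ m n ⟩
    m × 1# - n × 1#                      ≈⟨ +-identityˡ _ ⟨
    0# + (m × 1# - n × 1#)               ≈⟨ +-congʳ (-‿inverseʳ 1#) ⟨
    (1# - 1#) + (m × 1# - n × 1#)        ≈⟨ interchange _ _ _ _ ⟩
    (1# + m × 1#) + (- 1# - n × 1#)      ≈⟨ +-cong (1+× m 1#) (trans (-‿cong (1+× n 1#)) (sym (-‿+-comm 1# _))) ⟨
    suc m × 1# - suc n × 1#              ∎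

  fromℤ-+ : ∀ i j → fromℤ (i ℤ.+ j) ≈ fromℤ i + fromℤ j
  fromℤ-+ -[1+ m ] -[1+ n ] = begin
    - (suc (suc (m ℕ.+ n)) × 1#)      ≡⟨ ≡.cong (λ k → - (suc k × 1#)) (ℕₚ.+-suc m n) ⟨
    - ((suc m ℕ.+ suc n) × 1#)        ≈⟨ -‿cong (×-homo-+ 1# (suc m) (suc n)) ⟩
    - (suc m × 1# + suc n × 1#)       ≈⟨ -‿+-comm _ _ ⟨
    - (suc m × 1#) - suc n × 1#       ∎
  fromℤ-+ -[1+ m ] (+ n)    = trans (fromℤ-⊖ n (suc m)) (+-comm _ _)
  fromℤ-+ (+ m)    -[1+ n ] = fromℤ-⊖ m (suc n)
  fromℤ-+ (+ m)    (+ n)    = ×-homo-+ 1# m n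

  fromℤ-neg : ∀ i → fromℤ (ℤ.- i) ≈ - fromℤ i
  fromℤ-neg -[1+ n ]    = sym (-‿involutive _)
  fromℤ-neg (+ zero)    = sym -0#≈0#
  fromℤ-neg (+ (suc n)) = refl

  fromℤ-*⁺ : ∀ m j → fromℤ (+ m ℤ.* j) ≈ m × 1# * fromℤ j
  fromℤ-*⁺ zero    j = sym (zeroˡ _)
  fromℤ-*⁺ (suc m) j = begin
    fromℤ (+ suc m ℤ.* j)             ≡⟨ ≡.cong fromℤ (ℤₚ.suc-* (+ m) j) ⟩
    fromℤ (j ℤ.+ + m ℤ.* j)           ≈⟨ trans (fromℤ-+ j _) (+-congˡ (fromℤ-*⁺ m j)) ⟩
    fromℤ j + m × 1# * fromℤ j        ≈⟨ +-congʳ (*-identityˡ _) ⟨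
    1# * fromℤ j + m × 1# * fromℤ j   ≈⟨ distribʳ _ _ _ ⟨
    (1# + m × 1#) * fromℤ j           ≈⟨ *-congʳ (1+× m 1#) ⟨
    suc m × 1# * fromℤ j              ∎

  fromℤ-* : ∀ i j → fromℤ (i ℤ.* j) ≈ fromℤ i * fromℤ j
  fromℤ-* (+ m)    j = fromℤ-*⁺ m j
  fromℤ-* -[1+ m ] j = begin
    fromℤ (-[1+ m ] ℤ.* j)            ≡⟨ ≡.cong fromℤ (ℤₚ.neg-distribˡ-* (+ suc m) j) ⟨
    fromℤ (ℤ.- (+ suc m ℤ.* j))       ≈⟨ trans (fromℤ-neg (+ suc m ℤ.* j)) (-‿cong (fromℤ-*⁺ (suc m) j)) ⟩
    - (suc m × 1# * fromℤ j)          ≈⟨ -‿distribˡ-* _ _ ⟩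
    fromℤ -[1+ m ] * fromℤ j          ∎

  ℤ-morphism : ℤ.+-*-rawRing -Raw-AlmostCommutative⟶ fromCommutativeRing R
  ℤ-morphism = record
    { ⟦_⟧ = fromℤ ; +-homo = fromℤ-+ ; *-homo = fromℤ-* ; -‿homo = fromℤ-neg
    ; 0-homo = refl ; 1-homo = refl }

  fromℤ-≟ : ∀ i j → Maybe (fromℤ i ≈ fromℤ j)
  fromℤ-≟ i j with i ℤ.≟ j
  ... | yes ≡.refl = just refl
  ... | no _       = nothing

  open import Algebra.Solver.Ring ℤ.+-*-rawRing (fromCommutativeRing R) ℤ-morphism fromℤ-≟ public
    using (solve; _:=_; _:+_; _:*_; _:-_; :-_; con)


module FiniteSums {c ℓ} (R : CommutativeRing c ℓ) where
  open CommutativeRing R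
  open IntegerCoefficients R
  open import Algebra.Properties.CommutativeSemigroup +-commutativeSemigroup using (interchange)

  sum0-cong : ∀ n {f g : ℕ → Carrier} → (∀ m → f m ≈ g m) → sum0 R n f ≈ sum0 R n g
  sum0-cong zero    f≈g = f≈g 0
  sum0-cong (suc n) f≈g = +-cong (sum0-cong n f≈g) (f≈g (suc n))

  sum1-cong : ∀ K {f g : ℕ → Carrier} → (∀ k → f (suc k) ≈ g (suc k)) → sum1 R K f ≈ sum1 R K g
  sum1-cong zero    f≈g = refl
  sum1-cong (suc K) f≈g = +-cong (sum1-cong K f≈g) (f≈g K)

  sum0-+ : ∀ n (f g : ℕ → Carrier) → sum0 R n (λ i → f i + g i) ≈ sum0 R n f + sum0 R n g
  sum0-+ zero    f g = refl
  sum0-+ (suc n) f g = trans (+-congʳ (sum0-+ n f g)) (interchange _ _ _ _)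

  sum1-+ : ∀ K (f g : ℕ → Carrier) → sum1 R K (λ k → f k + g k) ≈ sum1 R K f + sum1 R K g
  sum1-+ zero    f g = sym (+-identityʳ 0#)
  sum1-+ (suc K) f g = trans (+-congʳ (sum1-+ K f g)) (interchange _ _ _ _)

  *-distribˡ-sum0 : ∀ n a (f : ℕ → Carrier) → a * sum0 R n f ≈ sum0 R n (λ i → a * f i)
  *-distribˡ-sum0 zero    a f = refl
  *-distribˡ-sum0 (suc n) a f = trans (distribˡ a _ _) (+-congʳ (*-distribˡ-sum0 n a f))

  *-distribˡ-sum1 : ∀ K a (f : ℕ → Carrier) → a * sum1 R K f ≈ sum1 R K (λ k → a * f k)
  *-distribˡ-sum1 zero    a f = zeroʳ a
  *-distribˡ-sum1 (suc K) a f = trans (distribˡ a _ _) (+-congʳ (*-distribˡ-sum1 K a f))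

  sum0-zero : ∀ n → sum0 R n (λ _ → 0#) ≈ 0#
  sum0-zero zero    = refl
  sum0-zero (suc n) = trans (+-congʳ (sum0-zero n)) (+-identityʳ 0#)

  sum0-suc : ∀ n (f : ℕ → Carrier) → sum0 R (suc n) f ≈ f 0 + sum0 R n (f ∘ suc)
  sum0-suc zero    f = refl
  sum0-suc (suc n) f = trans (+-congʳ (sum0-suc n f)) (+-assoc _ _ _)

  sum1-sum0-comm : ∀ K n (F : ℕ → ℕ → Carrier) →
    sum1 R K (λ k → sum0 R n (F k)) ≈ sum0 R n (λ l → sum1 R K (λ k → F k l))
  sum1-sum0-comm zero    n F = sym (sum0-zero n)
  sum1-sum0-comm (suc K) n F = trans (+-congʳ (sum1-sum0-comm K n F)) (sym (sum0-+ n _ _))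

  summation-by-parts : ∀ K (f g : ℕ → Carrier) →
    sum1 R K (λ k → f k * sum1 R k g)
      ≈ sum1 R K f * sum1 R K g - sum1 R K (λ k → g k * sum1 R (pred k) f)
  summation-by-parts zero    f g = solve 0 (con (+ 0) := con (+ 0) :* con (+ 0) :- con (+ 0)) refl
  summation-by-parts (suc K) f g =
    trans (+-congʳ (summation-by-parts K f g)) (step _ _ _ (f (suc K)) (g (suc K)))
    where
    step : ∀ F G A a b → (F * G - A) + a * (G + b) ≈ (F + a) * (G + b) - (A + b * F)
    step = solve 5 (λ F G A a b → (F :* G :- A) :+ a :* (G :+ b)
                                 := (F :+ a) :* (G :+ b) :- (A :+ b :* F)) refl

module PowAndNatR {c ℓ} (R : CommutativeRing c ℓ) where
  open CommutativeRing R
  open import Algebra.Properties.Semiring.Mult semiring using (_×_)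
  open import Algebra.Properties.Semiring.Exp semiring using (_^_)
  open import Algebra.Properties.CommutativeSemiring.Exp commutativeSemiring using (^-distrib-*)
  open import Relation.Binary.Reasoning.Setoid setoid

  pow≡^ : ∀ x n → pow R x n ≡ x ^ n
  pow≡^ x zero    = ≡.refl
  pow≡^ x (suc n) = ≡.cong (x *_) (pow≡^ x n)

  natR≡×1 : ∀ n → natR R n ≡ n × 1#
  natR≡×1 zero    = ≡.refl
  natR≡×1 (suc n) = ≡.cong (λ x → 1# + x) (natR≡×1 n)

  pow-congˡ : ∀ n {x y} → x ≈ y → pow R x n ≈ pow R y n
  pow-congˡ zero    x≈y = refl
  pow-congˡ (suc n) x≈y = *-cong x≈y (pow-congˡ n x≈y)

  pow-distrib-* : ∀ x y n → pow R (x * y) n ≈ pow R x n * pow R y n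
  pow-distrib-* x y n = begin
    pow R (x * y) n          ≡⟨ pow≡^ (x * y) n ⟩
    (x * y) ^ n              ≈⟨ ^-distrib-* x y n ⟩
    x ^ n * y ^ n            ≡⟨ ≡.cong₂ _*_ (pow≡^ x n) (pow≡^ y n) ⟨
    pow R x n * pow R y n    ∎

module AlternatingBinomialSums {c ℓ} (R : CommutativeRing c ℓ) where
  open CommutativeRing R
  open IntegerCoefficients R
  open FiniteSums R
  open PowAndNatR R
  open import Algebra.Properties.Semiring.Mult semiring using (_×_; ×-assoc-*; ×-congʳ)
  open import Algebra.Properties.Semiring.Exp semiring using (_^_)
  open import Algebra.Properties.Monoid.Sum +-monoid using (sum⁺-syntax)
  import Algebra.Properties.CommutativeSemiring.Binomial commutativeSemiring as Binomial
  open import Relation.Binary.Reasoning.Setoid setoid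

  altBinomial : ℕ → (ℕ → Carrier) → Carrier
  altBinomial l f = sum0 R l (λ m → natR R (l C m) * pow R (- 1#) (l ∸ m) * f m)

  altBinomial-cong : ∀ l {f g : ℕ → Carrier} → (∀ m → f m ≈ g m) → altBinomial l f ≈ altBinomial l g
  altBinomial-cong l f≈g = sum0-cong l (λ m → *-congˡ (f≈g m))

  altBinomial-* : ∀ l a (f : ℕ → Carrier) → altBinomial l (λ m → a * f m) ≈ a * altBinomial l f
  altBinomial-* l a f = begin
    altBinomial l (λ m → a * f m)                    ≈⟨ sum0-cong l (λ m → x*[a*y]≈a*[x*y] _ a (f m)) ⟩
    sum0 R l (λ m → a * (natR R (l C m) * pow R (- 1#) (l ∸ m) * f m)) ≈⟨ *-distribˡ-sum0 l a _ ⟨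
    a * altBinomial l f                              ∎
    where
    x*[a*y]≈a*[x*y] : ∀ x a y → x * (a * y) ≈ a * (x * y)
    x*[a*y]≈a*[x*y] = solve 3 (λ x a y → x :* (a :* y) := a :* (x :* y)) refl

  sum1-altBinomial-comm : ∀ K l (F : ℕ → ℕ → Carrier) →
    sum1 R K (λ k → altBinomial l (F k)) ≈ altBinomial l (λ m → sum1 R K (λ k → F k m))
  sum1-altBinomial-comm K l F = trans (sum1-sum0-comm K l _)
    (sum0-cong l (λ m → sym (*-distribˡ-sum1 K _ (λ k → F k m))))

  sum0≈∑ : ∀ n (f : ℕ → Carrier) → sum0 R n f ≈ ∑[ k ≤ n ] f (toℕ k)
  sum0≈∑ zero    f = sym (+-identityʳ (f 0))
  sum0≈∑ (suc n) f = trans (sum0-suc n f) (+-congˡ (sum0≈∑ n (f ∘ suc)))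

  altBinomial-pow : ∀ l x → altBinomial l (pow R x) ≈ pow R (x - 1#) l
  altBinomial-pow l x = begin
    altBinomial l (pow R x)                                    ≈⟨ sum0-cong l term ⟩
    sum0 R l (λ m → (l C m) × (x ^ m * (- 1#) ^ (l ∸ m)))      ≈⟨ sum0≈∑ l _ ⟩
    Binomial.binomialExpansion x (- 1#) l                      ≈⟨ Binomial.theorem l x (- 1#) ⟨
    (x - 1#) ^ l                                               ≡⟨ pow≡^ (x - 1#) l ⟨
    pow R (x - 1#) l                                           ∎
    where
    term : ∀ m → natR R (l C m) * pow R (- 1#) (l ∸ m) * pow R x m ≈ (l C m) × (x ^ m * (- 1#) ^ (l ∸ m))
    term m = begin
      natR R (l C m) * pow R (- 1#) (l ∸ m) * pow R x m
        ≡⟨ ≡.cong₂ _*_ (≡.cong₂ _*_ (natR≡×1 (l C m)) (pow≡^ (- 1#) (l ∸ m))) (pow≡^ x m) ⟩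
      (l C m) × 1# * (- 1#) ^ (l ∸ m) * x ^ m                  ≈⟨ *-assoc _ _ _ ⟩
      (l C m) × 1# * ((- 1#) ^ (l ∸ m) * x ^ m)                ≈⟨ ×-assoc-* (l C m) 1# _ ⟩
      (l C m) × (1# * ((- 1#) ^ (l ∸ m) * x ^ m))              ≈⟨ ×-congʳ (l C m) (trans (*-identityˡ _) (*-comm _ _)) ⟩
      (l C m) × (x ^ m * (- 1#) ^ (l ∸ m))                     ∎

module DifferenceOperators {c ℓ} (R : CommutativeRing c ℓ) where
  open CommutativeRing R
  open IntegerCoefficients R
  open import Relation.Binary.Reasoning.Setoid setoid

  Seq : Set c
  Seq = ℕ → Carrier

  infix 4 _≐_
  _≐_ : Seq → Seq → Set ℓ
  f ≐ g = ∀ K → f K ≈ g K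

  Vanishes : Seq → Set ℓ
  Vanishes f = ∀ K → f K ≈ 0#

  Δ : Carrier → Seq → Seq
  Δ a f K = f (suc K) - a * f K

  Δ^ : Carrier → ℕ → Seq → Seq
  Δ^ a zero    f = f
  Δ^ a (suc n) f = Δ^ a n (Δ a f)

  Annihilates : Carrier → ℕ → Seq → Set ℓ
  Annihilates a n f = Vanishes (Δ^ a n f)

  record IsLinear (T : Seq → Seq) : Set (c ⊔ ℓ) where
    field
      cong   : ∀ {f g} → f ≐ g → T f ≐ T g
      linear : ∀ p q f g → T (λ K → p * f K + q * g K) ≐ (λ K → p * T f K + q * T g K)

  module Kernel {T : Seq → Seq} (T-linear : IsLinear T) where
    open IsLinear T-linear

    kernel-cong : ∀ {f g} → f ≐ g → Vanishes (T f) → Vanishes (T g)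
    kernel-cong f≐g Tf≐0 K = trans (sym (cong f≐g K)) (Tf≐0 K)

    kernel-combination : ∀ p q {f g} → Vanishes (T f) → Vanishes (T g) →
                         Vanishes (T (λ K → p * f K + q * g K))
    kernel-combination p q {f} {g} Tf≐0 Tg≐0 K =
      trans (linear p q f g K)
        (trans (+-cong (*-congˡ (Tf≐0 K)) (*-congˡ (Tg≐0 K)))
          (trans (+-cong (zeroʳ p) (zeroʳ q)) (+-identityʳ 0#)))

    kernel-+ : ∀ {f g} → Vanishes (T f) → Vanishes (T g) → Vanishes (T (λ K → f K + g K))
    kernel-+ Tf≐0 Tg≐0 = kernel-cong (λ K → +-cong (*-identityˡ _) (*-identityˡ _))
                                     (kernel-combination 1# 1# Tf≐0 Tg≐0)

    kernel-* : ∀ p {f} → Vanishes (T f) → Vanishes (T (λ K → p * f K))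
    kernel-* p Tf≐0 = kernel-cong (λ K → trans (+-congˡ (zeroˡ _)) (+-identityʳ _))
                                  (kernel-combination p 0# Tf≐0 Tf≐0)

    vanishing-kernel : ∀ {f} → Vanishes f → Vanishes (T f)
    vanishing-kernel {f} f≐0 K =
      trans (cong f≐0+0 K) (trans (linear 0# 0# f f K) 0*x+0*y≈0)
      where
      0*x+0*y≈0 : ∀ {x y} → 0# * x + 0# * y ≈ 0#
      0*x+0*y≈0 = trans (+-cong (zeroˡ _) (zeroˡ _)) (+-identityʳ 0#)
      f≐0+0 : f ≐ (λ K → 0# * f K + 0# * f K)
      f≐0+0 K = trans (f≐0 K) (sym 0*x+0*y≈0)

    kernel-sum0 : ∀ n {F : ℕ → Seq} → (∀ l → l ≤ n → Vanishes (T (F l))) →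
                  Vanishes (T (λ K → sum0 R n (λ l → F l K)))
    kernel-sum0 zero    TF≐0 = TF≐0 0 z≤n
    kernel-sum0 (suc n) TF≐0 =
      kernel-+ (kernel-sum0 n (λ l l≤n → TF≐0 l (ℕₚ.m≤n⇒m≤1+n l≤n))) (TF≐0 (suc n) ℕₚ.≤-refl)

  id-linear : IsLinear (λ f → f)
  id-linear = record { cong = λ f≐g → f≐g ; linear = λ p q f g K → refl }

  ∘-linear : ∀ {T U} → IsLinear T → IsLinear U → IsLinear (T ∘ U)
  ∘-linear {T} {U} T-linear U-linear = record
    { cong   = λ f≐g → T.cong (U.cong f≐g)
    ; linear = λ p q f g K → trans (T.cong (U.linear p q f g) K) (T.linear p q (U f) (U g) K)
    }
    where
    module T = IsLinear T-linear
    module U = IsLinear U-linear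

  Δ-linear : ∀ a → IsLinear (Δ a)
  Δ-linear a = record
    { cong   = λ f≐g K → +-cong (f≐g (suc K)) (-‿cong (*-congˡ (f≐g K)))
    ; linear = λ p q f g K → Δ-combination p q a _ _ _ _
    }
    where
    Δ-combination : ∀ p q a f₁ f₀ g₁ g₀ →
      (p * f₁ + q * g₁) - a * (p * f₀ + q * g₀) ≈ p * (f₁ - a * f₀) + q * (g₁ - a * g₀)
    Δ-combination = solve 7 (λ p q a f₁ f₀ g₁ g₀ →
      (p :* f₁ :+ q :* g₁) :- a :* (p :* f₀ :+ q :* g₀) := p :* (f₁ :- a :* f₀) :+ q :* (g₁ :- a :* g₀)) refl

  Δ^-linear : ∀ a n → IsLinear (Δ^ a n)
  Δ^-linear a zero    = id-linear
  Δ^-linear a (suc n) = ∘-linear (Δ^-linear a n) (Δ-linear a)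

  open Kernel

  Δ-comm : ∀ a b f → Δ a (Δ b f) ≐ Δ b (Δ a f)
  Δ-comm a b f K = comm (f (suc (suc K))) (f (suc K)) (f K) a b
    where
    comm : ∀ f₂ f₁ f₀ a b → (f₂ - b * f₁) - a * (f₁ - b * f₀) ≈ (f₂ - a * f₁) - b * (f₁ - a * f₀)
    comm = solve 5 (λ f₂ f₁ f₀ a b →
      (f₂ :- b :* f₁) :- a :* (f₁ :- b :* f₀) := (f₂ :- a :* f₁) :- b :* (f₁ :- a :* f₀)) refl

  commute-Δ^ : ∀ {T} → IsLinear T → ∀ b → (∀ f → T (Δ b f) ≐ Δ b (T f)) →
               ∀ n f → T (Δ^ b n f) ≐ Δ^ b n (T f)
  commute-Δ^ T-linear b T∘Δ≐Δ∘T zero    f K = refl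
  commute-Δ^ T-linear b T∘Δ≐Δ∘T (suc n) f K =
    trans (commute-Δ^ T-linear b T∘Δ≐Δ∘T n (Δ b f) K) (IsLinear.cong (Δ^-linear b n) (T∘Δ≐Δ∘T f) K)

  Δ^-comm : ∀ a m b n f → Δ^ a m (Δ^ b n f) ≐ Δ^ b n (Δ^ a m f)
  Δ^-comm a m b n = commute-Δ^ (Δ^-linear a m) b
    (λ f K → sym (commute-Δ^ (Δ-linear b) a (Δ-comm b a) m f K)) n

  Δ^-shift : ∀ a n f K → Δ^ a n (f ∘ suc) K ≡ Δ^ a n f (suc K)
  Δ^-shift a zero    f K = ≡.refl
  Δ^-shift a (suc n) f K = Δ^-shift a n (Δ a f) K

  annihilates-shift : ∀ a n {f} → Annihilates a n f → Annihilates a n (f ∘ suc)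
  annihilates-shift a n {f} Δ^f≐0 K = trans (reflexive (Δ^-shift a n f K)) (Δ^f≐0 (suc K))

  Δ^-vanishes-from-1 : ∀ a n {f} → (∀ K → f (suc K) ≈ 0#) → ∀ K → Δ^ a n f (suc K) ≈ 0#
  Δ^-vanishes-from-1 a n {f} f₊≐0 K =
    trans (reflexive (≡.sym (Δ^-shift a n f K))) (vanishing-kernel (Δ^-linear a n) f₊≐0 K)

  Δ^-+ : ∀ a n m f → Δ^ a (n ℕ.+ m) f ≡ Δ^ a m (Δ^ a n f)
  Δ^-+ a zero    m f = ≡.refl
  Δ^-+ a (suc n) m f = Δ^-+ a n m (Δ a f)

  annihilates-≤ : ∀ {a n m f} → n ≤ m → Annihilates a n f → Annihilates a m f
  annihilates-≤ {a} {n} {m} {f} n≤m Δ^f≐0 = ≡.subst (λ k → Annihilates a k f) (ℕₚ.m+[n∸m]≡n n≤m)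
    (≡.subst Vanishes (≡.sym (Δ^-+ a n (m ∸ n) f)) (vanishing-kernel (Δ^-linear a (m ∸ n)) Δ^f≐0))

  Δ1-natR* : ∀ f → Δ 1# (λ K → natR R K * f K) ≐ (λ K → natR R K * Δ 1# f K + f (suc K))
  Δ1-natR* f K = leibniz (natR R K) (f (suc K)) (f K)
    where
    leibniz : ∀ k x y → (1# + k) * x - 1# * (k * y) ≈ k * (x - 1# * y) + x
    leibniz = solve 3 (λ k x y →
      (con (+ 1) :+ k) :* x :- con (+ 1) :* (k :* y) := k :* (x :- con (+ 1) :* y) :+ x) refl

  annihilates-natR* : ∀ d f → Annihilates 1# d f → Annihilates 1# (suc d) (λ K → natR R K * f K)
  annihilates-natR* zero    f f≐0 =
    vanishing-kernel (Δ-linear 1#) (λ K → trans (*-congˡ (f≐0 K)) (zeroʳ _))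
  annihilates-natR* (suc d) f Δ^f≐0 =
    kernel-cong (Δ^-linear 1# (suc d)) (λ K → sym (Δ1-natR* f K))
      (kernel-+ (Δ^-linear 1# (suc d)) (annihilates-natR* d (Δ 1# f) Δ^f≐0) (annihilates-shift 1# (suc d) Δ^f≐0))

  annihilates-powers : ∀ l → Annihilates 1# (suc l) (λ K → pow R (natR R K) l)
  annihilates-powers zero    K = trans (+-congˡ (-‿cong (*-identityˡ 1#))) (-‿inverseʳ 1#)
  annihilates-powers (suc l) = annihilates-natR* (suc l) _ (annihilates-powers l)

  Δ-pow* : ∀ z f → Δ z (λ K → pow R z K * f K) ≐ (λ K → pow R z K * (z * Δ 1# f K))
  Δ-pow* z f K = factor z (pow R z K) (f (suc K)) (f K)
    where
    factor : ∀ z zᴷ x y → z * zᴷ * x - z * (zᴷ * y) ≈ zᴷ * (z * (x - 1# * y))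
    factor = solve 4 (λ z zᴷ x y →
      z :* zᴷ :* x :- z :* (zᴷ :* y) := zᴷ :* (z :* (x :- con (+ 1) :* y))) refl

  annihilates-pow* : ∀ z n f → Annihilates 1# n f → Annihilates z n (λ K → pow R z K * f K)
  annihilates-pow* z zero    f f≐0 K = trans (*-congˡ (f≐0 K)) (zeroʳ _)
  annihilates-pow* z (suc n) f Δ^f≐0 =
    kernel-cong (Δ^-linear z n) (λ K → sym (Δ-pow* z f K))
      (annihilates-pow* z n _ (kernel-* (Δ^-linear 1# n) z Δ^f≐0))

  annihilated-vanishes-at-0 : ∀ {a b} n {h} → b * a ≈ 1# → Annihilates a n h →
                              (∀ K → h (suc K) ≈ 0#) → h 0 ≈ 0#
  annihilated-vanishes-at-0 zero    ba≈1 h≐0 h₊≐0 = h≐0 0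
  annihilated-vanishes-at-0 {a} {b} (suc n) {h} ba≈1 Δ^h≐0 h₊≐0 = begin
    h 0                          ≈⟨ *-identityˡ (h 0) ⟨
    1# * h 0                     ≈⟨ *-congʳ ba≈1 ⟨
    b * a * h 0                  ≈⟨ recover b a (h 0) (h 1) ⟩
    b * (h 1 - Δ a h 0)          ≈⟨ *-congˡ (+-cong (h₊≐0 0) (-‿cong Δh0≈0)) ⟩
    b * (0# - 0#)                ≈⟨ solve 1 (λ b → b :* (con (+ 0) :- con (+ 0)) := con (+ 0)) refl b ⟩
    0#                           ∎
    where
    recover : ∀ b a h₀ h₁ → b * a * h₀ ≈ b * (h₁ - (h₁ - a * h₀))
    recover = solve 4 (λ b a h₀ h₁ → b :* a :* h₀ := b :* (h₁ :- (h₁ :- a :* h₀))) refl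
    Δh0≈0 : Δ a h 0 ≈ 0#
    Δh0≈0 = annihilated-vanishes-at-0 n ba≈1 Δ^h≐0 (Δ^-vanishes-from-1 a 1 {h} h₊≐0)

  annihilated-vanishes : ∀ {a b} n {h} → b * a ≈ 1# → Annihilates a n h →
                         (∀ K → h (suc K) ≈ 0#) → Vanishes h
  annihilated-vanishes n ba≈1 Δ^h≐0 h₊≐0 zero    = annihilated-vanishes-at-0 n ba≈1 Δ^h≐0 h₊≐0
  annihilated-vanishes n ba≈1 Δ^h≐0 h₊≐0 (suc K) = h₊≐0 K

module ClosedForm {c ℓ} (R : CommutativeRing c ℓ) where
  open CommutativeRing R
  open IntegerCoefficients R
  open DifferenceOperators R
  open Kernel
  open import Relation.Binary.Reasoning.Setoid setoid

  -- The right-hand side of P_s(K,z) = Σ_ℓ (z^K a_{1,ℓ} + a_{2,ℓ}) / (1-z)^{s+1} · K^ℓ, with c = (1-z)^{-(s+1)}.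
  closedForm : ℕ → Carrier → Carrier → (ℕ → Carrier) → (ℕ → Carrier) → Seq
  closedForm s z c a₁ a₂ K = sum0 R s (λ l → (pow R z K * a₁ l + a₂ l) * c * pow R (natR R K) l)

  module _ (s : ℕ) (z : Carrier) where

    annihilator : Seq → Seq
    annihilator = Δ^ 1# (suc (suc s)) ∘ Δ^ z (suc s)

    annihilator-linear : IsLinear annihilator
    annihilator-linear = ∘-linear (Δ^-linear 1# (suc (suc s))) (Δ^-linear z (suc s))

    closedForm-annihilated : ∀ c a₁ a₂ → Vanishes (annihilator (closedForm s z c a₁ a₂))
    closedForm-annihilated c a₁ a₂ = kernel-sum0 annihilator-linear s λ l l≤s →
      kernel-cong annihilator-linear (λ K → regroup (pow R z K) (a₁ l) (a₂ l) (pow R (natR R K) l))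
        (kernel-+ annihilator-linear (exponential-part l≤s (a₁ l * c)) (polynomial-part l≤s (a₂ l * c)))
      where
      regroup : ∀ zᴷ a b N → zᴷ * (a * c * N) + b * c * N ≈ (zᴷ * a + b) * c * N
      regroup zᴷ a b N = solve 5 (λ zᴷ a b N c → zᴷ :* (a :* c :* N) :+ b :* c :* N := (zᴷ :* a :+ b) :* c :* N)
                           refl zᴷ a b N c
      scaled-power : ∀ {l} → l ≤ s → ∀ a → Annihilates 1# (suc s) (λ K → a * pow R (natR R K) l)
      scaled-power {l} l≤s a = kernel-* (Δ^-linear 1# (suc s)) a (annihilates-≤ (s≤s l≤s) (annihilates-powers l))
      exponential-part : ∀ {l} → l ≤ s → ∀ a →
                         Vanishes (annihilator (λ K → pow R z K * (a * pow R (natR R K) l)))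
      exponential-part l≤s a =
        vanishing-kernel (Δ^-linear 1# (suc (suc s))) (annihilates-pow* z (suc s) _ (scaled-power l≤s a))
      polynomial-part : ∀ {l} → l ≤ s → ∀ a → Vanishes (annihilator (λ K → a * pow R (natR R K) l))
      polynomial-part l≤s a K = trans (Δ^-comm 1# (suc (suc s)) z (suc s) _ K)
        (vanishing-kernel (Δ^-linear z (suc s)) (annihilates-≤ (ℕₚ.n≤1+n (suc s)) (scaled-power l≤s a)) K)

    P-annihilated : Vanishes (annihilator (λ K → P R s K z))
    P-annihilated =
      kernel-cong (Δ^-linear 1# (suc s)) (λ K → sym (Δ^-comm 1# 1 z (suc s) _ K))
        (vanishing-kernel (Δ^-linear 1# (suc s))
          (kernel-cong (Δ^-linear z (suc s)) ΔP
            (annihilates-pow* z (suc s) _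
              (kernel-* (Δ^-linear 1# (suc s)) z (annihilates-shift 1# (suc s) (annihilates-powers s))))))
      where
      ΔP : (λ K → pow R z K * (z * pow R (natR R (suc K)) s)) ≐ Δ 1# (λ K → P R s K z)
      ΔP K = last-term (pow R z K) z (pow R (natR R (suc K)) s) (P R s K z)
        where
        last-term : ∀ zᴷ z N p → zᴷ * (z * N) ≈ (p + N * (z * zᴷ)) - 1# * p
        last-term = solve 4 (λ zᴷ z N p → zᴷ :* (z :* N) := (p :+ N :* (z :* zᴷ)) :- con (+ 1) :* p) refl

    closedForm-extends-to-0 : ∀ {u c a₁ a₂} → z * u ≈ 1# →
      (∀ K → K ≥ 1 → P R s K z ≈ closedForm s z c a₁ a₂ K) →
      ∀ K → P R s K z ≈ closedForm s z c a₁ a₂ K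
    closedForm-extends-to-0 {u} {c} {a₁} {a₂} zu≈1 P≈g K = begin
      P R s K z               ≈⟨ solve 2 (λ p g → p := g :- (con (+ 1) :* g :+ :- con (+ 1) :* p)) refl _ _ ⟩
      g K - h K               ≈⟨ +-congˡ (-‿cong (h≐0 K)) ⟩
      g K - 0#                ≈⟨ solve 1 (λ x → x :- con (+ 0) := x) refl _ ⟩
      g K                     ∎
      where
      g h : Seq
      g = closedForm s z c a₁ a₂
      h K = 1# * g K + - 1# * P R s K z
      h₊≐0 : ∀ K → h (suc K) ≈ 0#
      h₊≐0 K = trans (+-congˡ (*-congˡ (P≈g (suc K) (s≤s z≤n))))
                 (solve 1 (λ x → con (+ 1) :* x :+ :- con (+ 1) :* x := con (+ 0)) refl _)
      h≐0 : Vanishes h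
      h≐0 = annihilated-vanishes (suc s) (trans (*-comm u z) zu≈1)
              (annihilated-vanishes (suc (suc s)) (*-identityˡ 1#)
                (kernel-combination annihilator-linear 1# (- 1#) (closedForm-annihilated c a₁ a₂) P-annihilated)
                (Δ^-vanishes-from-1 z (suc s) h₊≐0))
              h₊≐0

module TruncatedPolylogarithms {c ℓ} (R : CommutativeRing c ℓ) (inv : ℕ → CommutativeRing.Carrier R) where
  open CommutativeRing R
  open IntegerCoefficients R
  open FiniteSums R
  open AlternatingBinomialSums R
  open ClosedForm R
  open PowAndNatR R
  open import Relation.Binary.Reasoning.Setoid setoid

  invPow-neg : ∀ k s → invPow R inv k (-ℤ (+ s)) ≡ pow R (natR R k) s
  invPow-neg k zero    = ≡.refl
  invPow-neg k (suc s) = ≡.refl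

  module _ {k : ℕ} (k*inv≈1 : natR R k * inv k ≈ 1#) where

    invPow-pred : ∀ t → invPow R inv k (t -ℤ + 1) ≈ invPow R inv k t * natR R k
    invPow-pred (+ zero)    = *-comm _ _
    invPow-pred (+ (suc n)) = sym (begin
      inv k * pow R (inv k) n * natR R k     ≈⟨ solve 3 (λ i x k → i :* x :* k := k :* i :* x) refl _ _ _ ⟩
      natR R k * inv k * pow R (inv k) n     ≈⟨ *-congʳ k*inv≈1 ⟩
      1# * pow R (inv k) n                   ≈⟨ *-identityˡ _ ⟩
      pow R (inv k) n                        ∎)
    invPow-pred -[1+ n ] rewrite ℕₚ.+-identityʳ n = *-comm _ _

    invPow-sub : ∀ t m → invPow R inv k (t -ℤ + m) ≈ invPow R inv k t * pow R (natR R k) m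
    invPow-sub t zero    rewrite ℤₚ.+-identityʳ t = sym (*-identityʳ _)
    invPow-sub t (suc m) = begin
      invPow R inv k (t -ℤ + suc m)                      ≡⟨ ≡.cong (invPow R inv k) t-[1+m]≡t-1-m ⟩
      invPow R inv k ((t -ℤ + 1) -ℤ + m)                 ≈⟨ invPow-sub (t -ℤ + 1) m ⟩
      invPow R inv k (t -ℤ + 1) * pow R (natR R k) m     ≈⟨ *-congʳ (invPow-pred t) ⟩
      invPow R inv k t * natR R k * pow R (natR R k) m   ≈⟨ *-assoc _ _ _ ⟩
      invPow R inv k t * pow R (natR R k) (suc m)        ∎
      where
      t-[1+m]≡t-1-m : t -ℤ + suc m ≡ (t -ℤ + 1) -ℤ + m
      t-[1+m]≡t-1-m = ≡.trans (≡.cong (λ i → t ℤ.+ i) (ℤₚ.neg-distrib-+ (+ 1) (+ m)))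
                              (≡.sym (ℤₚ.+-assoc t (-ℤ + 1) (-ℤ + m)))

  La-term : ∀ {n} → ℤ → Carrier → Vec ℤ n → Vec Carrier n → ℕ → Carrier
  La-term s y ss zs k = pow R y k * invPow R inv k s * La R inv k ss zs

  La-neg-head : ∀ {n} K s z (ss : Vec ℤ n) zs →
    La R inv K (-ℤ (+ s) ∷ ss) (z ∷ zs) ≈ sum1 R K (λ k → pow R (natR R k) s * pow R z k * La R inv k ss zs)
  La-neg-head K s z ss zs =
    sum1-cong K (λ j → *-congʳ (trans (*-congˡ (reflexive (invPow-neg (suc j) s))) (*-comm _ _)))

  La-term-* : ∀ {n} t x y (ss : Vec ℤ n) zs k → La-term t (x * y) ss zs k ≈ pow R x k * La-term t y ss zs k
  La-term-* t x y ss zs k = begin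
    pow R (x * y) k * I * L             ≈⟨ *-congʳ (*-congʳ (pow-distrib-* x y k)) ⟩
    pow R x k * pow R y k * I * L       ≈⟨ solve 4 (λ a b i l → a :* b :* i :* l := a :* (b :* i :* l)) refl _ _ _ _ ⟩
    pow R x k * (pow R y k * I * L)     ∎
    where
    I L : Carrier
    I = invPow R inv k t
    L = La R inv k ss zs

  module _ (inv-correct : ∀ k → k ≥ 1 → natR R k * inv k ≈ 1#) where

    altBinomial-La : ∀ {n} K l t y (ss : Vec ℤ n) zs →
      altBinomial l (λ m → La R inv K ((t -ℤ + m) ∷ ss) (y ∷ zs))
        ≈ sum1 R K (λ k → La-term t y ss zs k * pow R (natR R (pred k)) l)
    altBinomial-La K l t y ss zs = begin
      altBinomial l (λ m → sum1 R K (La-term (t -ℤ + m) y ss zs))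
        ≈⟨ sum1-altBinomial-comm K l (λ k m → La-term (t -ℤ + m) y ss zs k) ⟨
      sum1 R K (λ k → altBinomial l (λ m → La-term (t -ℤ + m) y ss zs k))
        ≈⟨ sum1-cong K term ⟩
      sum1 R K (λ k → La-term t y ss zs k * pow R (natR R (pred k)) l) ∎
      where
      term : ∀ j → altBinomial l (λ m → La-term (t -ℤ + m) y ss zs (suc j))
                   ≈ La-term t y ss zs (suc j) * pow R (natR R j) l
      term j = begin
        altBinomial l (λ m → La-term (t -ℤ + m) y ss zs (suc j))  ≈⟨ altBinomial-cong l shift ⟩
        altBinomial l (λ m → T * pow R (natR R (suc j)) m)       ≈⟨ altBinomial-* l T _ ⟩
        T * altBinomial l (pow R (natR R (suc j)))               ≈⟨ *-congˡ (altBinomial-pow l _) ⟩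
        T * pow R (natR R (suc j) - 1#) l                        ≈⟨ *-congˡ (pow-congˡ l [1+x]-1≈x) ⟩
        T * pow R (natR R j) l                                   ∎
        where
        T : Carrier
        T = La-term t y ss zs (suc j)
        [1+x]-1≈x : natR R (suc j) - 1# ≈ natR R j
        [1+x]-1≈x = solve 1 (λ x → (con (+ 1) :+ x) :- con (+ 1) := x) refl (natR R j)
        shift : ∀ m → La-term (t -ℤ + m) y ss zs (suc j) ≈ T * pow R (natR R (suc j)) m
        shift m = trans (*-congʳ (*-congˡ (invPow-sub (inv-correct (suc j) (s≤s z≤n)) t m)))
                        (solve 4 (λ a i p l → a :* (i :* p) :* l := a :* i :* l :* p) refl _ _ _ _)

    correction-terms : ∀ {n} K s {z u} c (a₁ a₂ : ℕ → Carrier) t y (ss : Vec ℤ n) zs → z * u ≈ 1# →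
      sum0 R s (λ l → a₁ l * c * u * altBinomial l (λ m → La R inv K ((t -ℤ + m) ∷ ss) ((z * y) ∷ zs)))
      + sum0 R s (λ l → a₂ l * c * altBinomial l (λ m → La R inv K ((t -ℤ + m) ∷ ss) (y ∷ zs)))
        ≈ sum1 R K (λ k → La-term t y ss zs k * closedForm s z c a₁ a₂ (pred k))
    correction-terms K s {z} {u} c a₁ a₂ t y ss zs zu≈1 = begin
      sum0 R s (λ l → a₁ l * c * u * altBinomial l _) + sum0 R s (λ l → a₂ l * c * altBinomial l _)
        ≈⟨ +-cong (sum0-cong s (λ l → *-congˡ (altBinomial-La K l t (z * y) ss zs)))
                  (sum0-cong s (λ l → *-congˡ (altBinomial-La K l t y ss zs))) ⟩
      sum0 R s (λ l → a₁ l * c * u * sum1 R K (A l)) + sum0 R s (λ l → a₂ l * c * sum1 R K (B l))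
        ≈⟨ +-cong (sum0-cong s (λ l → *-distribˡ-sum1 K _ _)) (sum0-cong s (λ l → *-distribˡ-sum1 K _ _)) ⟩
      sum0 R s (λ l → sum1 R K (λ k → a₁ l * c * u * A l k)) + sum0 R s (λ l → sum1 R K (λ k → a₂ l * c * B l k))
        ≈⟨ trans (sum0-cong s (λ l → sum1-+ K _ _)) (sum0-+ s _ _) ⟨
      sum0 R s (λ l → sum1 R K (λ k → a₁ l * c * u * A l k + a₂ l * c * B l k))
        ≈⟨ sum1-sum0-comm K s _ ⟨
      sum1 R K (λ k → sum0 R s (λ l → a₁ l * c * u * A l k + a₂ l * c * B l k))
        ≈⟨ sum1-cong K (λ j → trans (sum0-cong s (term j)) (sym (*-distribˡ-sum0 s _ _))) ⟩
      sum1 R K (λ k → La-term t y ss zs k * closedForm s z c a₁ a₂ (pred k)) ∎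
      where
      A B : ℕ → ℕ → Carrier
      A l k = La-term t (z * y) ss zs k * pow R (natR R (pred k)) l
      B l k = La-term t y ss zs k * pow R (natR R (pred k)) l
      term : ∀ j l → a₁ l * c * u * A l (suc j) + a₂ l * c * B l (suc j)
                     ≈ La-term t y ss zs (suc j) * ((pow R z j * a₁ l + a₂ l) * c * pow R (natR R j) l)
      term j l = begin
        a₁ l * c * u * A l (suc j) + a₂ l * c * (T * N)
          ≈⟨ +-congʳ (*-congˡ (*-congʳ (La-term-* t z y ss zs (suc j)))) ⟩
        a₁ l * c * u * (z * Z * T * N) + a₂ l * c * (T * N)
          ≈⟨ solve 8 (λ a₁ a₂ c u z Z T N → a₁ :* c :* u :* (z :* Z :* T :* N) :+ a₂ :* c :* (T :* N)
                      := z :* u :* (T :* (Z :* a₁ :* c :* N)) :+ T :* (a₂ :* c :* N)) refl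
                (a₁ l) (a₂ l) c u z Z T N ⟩
        z * u * (T * (Z * a₁ l * c * N)) + T * (a₂ l * c * N)
          ≈⟨ +-congʳ (*-congʳ zu≈1) ⟩
        1# * (T * (Z * a₁ l * c * N)) + T * (a₂ l * c * N)
          ≈⟨ solve 6 (λ a₁ a₂ c Z T N → con (+ 1) :* (T :* (Z :* a₁ :* c :* N)) :+ T :* (a₂ :* c :* N)
                      := T :* ((Z :* a₁ :+ a₂) :* c :* N)) refl
                (a₁ l) (a₂ l) c Z T N ⟩
        T * ((Z * a₁ l + a₂ l) * c * N) ∎
        where
        T Z N : Carrier
        T = La-term t y ss zs (suc j)
        Z = pow R z j
        N = pow R (natR R j) l

mainTheorem8 :
    ∀ {c ℓ} (R : CommutativeRing c ℓ) →
    let open CommutativeRing R in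
    -- inverses of the positive integers (characteristic 0, as in ℂ)
    (inv : ℕ → Carrier) → (∀ k → k ≥ 1 → natR R k * inv k ≈ 1#) →
    (n K s₁ : ℕ) → K ≥ 1 →
    (s₂ : ℤ) (ss : Vec ℤ n) (z₁ z₂ : Carrier) (zs : Vec Carrier n) →
    -- z₁ ≠ 0 (u = 1/z₁) and z₁ ≠ 1 (w = 1/(1 - z₁), implied by |z₁| < 1)
    (u w : Carrier) → z₁ * u ≈ 1# → (1# - z₁) * w ≈ 1# →
    -- a₁ ℓ = a_{1,ℓ}(s₁,z₁), a₂ ℓ = a_{2,ℓ}(s₁,z₁): the coefficients in
    -- P_{s₁}(K',z₁) = Σ_ℓ (z₁^{K'} a_{1,ℓ} + a_{2,ℓ}) / (1-z₁)^{s₁+1} · K'^ℓ  for all K' ≥ 1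
    (a₁ a₂ : ℕ → Carrier) →
    (∀ K′ → K′ ≥ 1 →
      P R s₁ K′ z₁ ≈ sum0 R s₁ (λ l →
        (pow R z₁ K′ * a₁ l + a₂ l) * pow R w (suc s₁) * pow R (natR R K′) l)) →
    La R inv K (-ℤ (+ s₁) ∷ s₂ ∷ ss) (z₁ ∷ z₂ ∷ zs)
      ≈ (P R s₁ K z₁ * La R inv K (s₂ ∷ ss) (z₂ ∷ zs)
         - sum0 R s₁ (λ l → a₁ l * pow R w (suc s₁) * u *
             sum0 R l (λ m → natR R (l C m) * pow R (- 1#) (l ∸ m) *
               La R inv K ((s₂ -ℤ + m) ∷ ss) ((z₁ * z₂) ∷ zs))))
        - sum0 R s₁ (λ l → a₂ l * pow R w (suc s₁) *
             sum0 R l (λ m → natR R (l C m) * pow R (- 1#) (l ∸ m) *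
               La R inv K ((s₂ -ℤ + m) ∷ ss) (z₂ ∷ zs)))
mainTheorem8 R inv inv-correct _ K s₁ _ s₂ ss z₁ z₂ zs u w z₁u≈1 _ a₁ a₂ P≈closedForm = begin
  La R inv K (-ℤ (+ s₁) ∷ s₂ ∷ ss) (z₁ ∷ z₂ ∷ zs)
    ≈⟨ La-neg-head K s₁ z₁ (s₂ ∷ ss) (z₂ ∷ zs) ⟩
  sum1 R K (λ k → pow R (natR R k) s₁ * pow R z₁ k * sum1 R k T)
    ≈⟨ summation-by-parts K _ T ⟩
  P R s₁ K z₁ * sum1 R K T - sum1 R K (λ k → T k * P R s₁ (pred k) z₁)
    ≈⟨ +-congˡ (-‿cong (sum1-cong K (λ j → *-congˡ (closedForm-extends-to-0 s₁ z₁ z₁u≈1 P≈closedForm j)))) ⟩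
  P R s₁ K z₁ * sum1 R K T - sum1 R K (λ k → T k * closedForm s₁ z₁ w′ a₁ a₂ (pred k))
    ≈⟨ +-congˡ (-‿cong (correction-terms inv-correct K s₁ w′ a₁ a₂ s₂ z₂ ss zs z₁u≈1)) ⟨
  P R s₁ K z₁ * sum1 R K T - (X₁ + X₂)
    ≈⟨ solve 3 (λ x y z → x :- (y :+ z) := x :- y :- z) refl _ X₁ X₂ ⟩
  P R s₁ K z₁ * sum1 R K T - X₁ - X₂ ∎
  where
  open CommutativeRing R
  open IntegerCoefficients R
  open FiniteSums R
  open AlternatingBinomialSums R
  open ClosedForm R
  open TruncatedPolylogarithms R inv
  open import Relation.Binary.Reasoning.Setoid setoid
  T : ℕ → Carrier
  T = La-term s₂ z₂ ss zs
  w′ : Carrier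
  w′ = pow R w (suc s₁)
  X₁ X₂ : Carrier
  X₁ = sum0 R s₁ (λ l → a₁ l * w′ * u * altBinomial l (λ m → La R inv K ((s₂ -ℤ + m) ∷ ss) ((z₁ * z₂) ∷ zs)))
  X₂ = sum0 R s₁ (λ l → a₂ l * w′ * altBinomial l (λ m → La R inv K ((s₂ -ℤ + m) ∷ ss) (z₂ ∷ zs)))
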